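{- Let $T$ be a finite rooted tree. Consider the recursive procedure $\mathrm{AssignClassic}(u,t)$ (for a node $u$ and an integer $t$) which does the following: (1) set $a(u), \overline{a}(u), b(u), \overline{b}(u)$ all equal to $t$; (2) for each child $v$ of $u$, in any order, call $\mathrm{AssignClassic}(v, \overline{b}(u)+1)$ (using the current value of $\overline{b}(u)$) and then set $\overline{a}(u) \gets \overline{a}(v)$ and $\overline{b}(u) \gets \overline{b}(v)$; (3) after all children are processed, set $b(u) \gets \overline{a}(u)$; (4) set $\overline{b}(u) \gets \max\{b(u), \overline{b}(u)\}$. Then for every node $u$ of $T$ and every integer $t$, after the call $\mathrm{AssignClassic}(u,t)$ terminates, \[ \overline{b}(u) - a(u) + 1 = |T_u|, \] where $T_u$ is the set of descendants of $u$ (including $u$).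
   Context: In a rooted tree, $v$ is a descendant of $u$ if $u$ lies on the unique path from the root to $v$; every node is a descendant of itself. -}

module Defs where

open import Data.Nat using (ℕ; suc; _+_)
open import Data.Integer using (ℤ; _⊔_; +_) renaming (_+_ to _+ℤ_)
open import Data.List using (List; []; _∷_)
open import Data.List.Relation.Unary.Any using (Any)
open import Data.Product using (_×_; _,_)

-- A finite rooted tree (rose tree): a node with an ordered list of children.
-- The list order is the (arbitrary) order in which AssignClassic visits children.
data Tree : Set where
  node : List Tree → Tree

children : Tree → List Tree
children (node cs) = cs

-- Nodes of a tree, given as positions: the root, or a node inside some child subtree.
-- The subtree at a position is the subtree T_u of descendants of that node.
data Node : Tree → Set where
  root  : ∀ {T} → Node T
  below : ∀ {cs} → Any Node cs → Node (node cs)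

subtreeAt : ∀ {T} → Node T → Tree
subtreeAnyAt : ∀ {cs} → Any Node cs → Tree
subtreeAt {T} root = T
subtreeAt (below p) = subtreeAnyAt p
subtreeAnyAt (Any.here p) = subtreeAt p
subtreeAnyAt (Any.there p) = subtreeAnyAt p

size : Tree → ℕ
sizes : List Tree → ℕ
size (node cs) = suc (sizes cs)
sizes [] = 0
sizes (c ∷ cs) = size c + sizes cs

descendantsCount : ∀ {T} → Node T → ℕ
descendantsCount u = size (subtreeAt u)

-- Values a(u), ā(u), b(u), b̄(u) of the node on which AssignClassic was called,
-- as they stand when the call terminates.
record Vals : Set where
  constructor vals
  field
    a  : ℤ
    a̅  : ℤ
    b  : ℤ
    b̅  : ℤ
open Vals public

-- AssignClassic(u,t), returning the final values at u (values at u depend only on T_u).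
assignClassic : Tree → ℤ → Vals
-- step (2): process the children in list order, carrying the current (ā(u), b̄(u));
-- each child v is called with t = b̄(u)+1 and then ā(u) ← ā(v), b̄(u) ← b̄(v).
processChildren : List Tree → ℤ → ℤ → ℤ × ℤ
-- step (1): a = ā = b = b̄ = t; step (3): b ← ā; step (4): b̄ ← max(b, b̄)
assignClassic (node cs) t with processChildren cs t t
... | (a̅u , b̅u) = vals t a̅u a̅u (a̅u ⊔ b̅u)
processChildren [] a̅u b̅u = (a̅u , b̅u)
processChildren (v ∷ vs) a̅u b̅u =
  let r = assignClassic v (b̅u +ℤ + 1)
  in processChildren vs (a̅ r) (b̅ r)

module Submission where

-- Proof idea.  Write (ā, b̄) for the pair of running values that step (2) of
-- AssignClassic(u,t) threads through the children of u.  Two invariants hold: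
--
--   * ordering: every call AssignClassic(v,s) ends with ā(v) ≤ b̄(v), because
--     step (4) sets b̄(v) to a maximum with b(v) = ā(v).  Hence the child loop
--     preserves ā ≤ b̄, and at the end of the loop at u the maximum in step (4)
--     leaves b̄(u) unchanged.
--   * value: each child v, started at b̄ + 1, raises b̄ by exactly |T_v|, so the
--     loop ends with b̄ = t + (|T_u| - 1); by the ordering fact this is also the
--     final value of b̄(u).
--
-- Since a(u) = t, the formula b̄(u) - a(u) + 1 = |T_u| follows for every tree,
-- in particular for the subtree T_u at any node u.

open import Defs
open import Data.Integer using (ℤ; _-_; _+_; +_; _≤_; _⊔_)
open import Data.Integer.Properties using (≤-refl; i≤i⊔j; i≤j⇒i⊔j≡j; +-assoc; +-identityʳ; pos-+)
open import Data.Integer.Tactic.RingSolver using (solve-∀)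
open import Data.List using (List; []; _∷_)
open import Data.Product using (proj₁; proj₂)
open import Relation.Binary.PropositionalEquality using (_≡_; cong; sym; trans; module ≡-Reasoning)

size-root : (T : Tree) → + size T ≡ + 1 + + sizes (children T)
size-root (node cs) = pos-+ 1 (sizes cs)

sizes-cons : (v : Tree) (vs : List Tree) → + sizes (v ∷ vs) ≡ + size v + + sizes vs
sizes-cons v vs = pos-+ (size v) (sizes vs)

assign-ordered : (T : Tree) (t : ℤ) → a̅ (assignClassic T t) ≤ b̅ (assignClassic T t)
assign-ordered (node cs) t = i≤i⊔j _ _

-- The child loop preserves ā ≤ b̄: after a nonempty loop the pair comes from a child call.
process-ordered : (cs : List Tree) (x y : ℤ) → x ≤ y →
  proj₁ (processChildren cs x y) ≤ proj₂ (processChildren cs x y)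
process-ordered []       x y x≤y = x≤y
process-ordered (v ∷ vs) x y _   =
  process-ordered vs _ _ (assign-ordered v (y + + 1))

assign-b̅ : (T : Tree) (t : ℤ) → b̅ (assignClassic T t) ≡ t + + sizes (children T)
process-b̅ : (cs : List Tree) (x y : ℤ) → proj₂ (processChildren cs x y) ≡ y + + sizes cs

-- Step (4) is harmless because the loop ends ordered (it starts with ā = b̄ = t).
assign-b̅ (node cs) t =
  trans (i≤j⇒i⊔j≡j (process-ordered cs t t ≤-refl)) (process-b̅ cs t t)

process-b̅ []       x y = sym (+-identityʳ y)
process-b̅ (v ∷ vs) x y = begin
  proj₂ (processChildren vs _ (b̅ (assignClassic v (y + + 1))))
    ≡⟨ process-b̅ vs _ _ ⟩
  b̅ (assignClassic v (y + + 1)) + + sizes vs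
    ≡⟨ cong (_+ + sizes vs) (assign-b̅ v (y + + 1)) ⟩
  y + + 1 + + sizes (children v) + + sizes vs
    ≡⟨ cong (_+ + sizes vs) (+-assoc y (+ 1) _) ⟩
  y + (+ 1 + + sizes (children v)) + + sizes vs
    ≡⟨ cong (λ s → y + s + + sizes vs) (sym (size-root v)) ⟩
  y + + size v + + sizes vs
    ≡⟨ +-assoc y (+ size v) (+ sizes vs) ⟩
  y + (+ size v + + sizes vs)
    ≡⟨ cong (λ s → y + s) (sym (sizes-cons v vs)) ⟩
  y + + sizes (v ∷ vs) ∎
  where open ≡-Reasoning

span-size : (T : Tree) (t : ℤ) →
  b̅ (assignClassic T t) - a (assignClassic T t) + + 1 ≡ + size T
span-size (node cs) t = begin
  b̅ (assignClassic (node cs) t) - t + + 1 ≡⟨ cong (λ s → s - t + + 1) (assign-b̅ (node cs) t) ⟩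
  t + + sizes cs - t + + 1               ≡⟨ cancel t (+ sizes cs) ⟩
  + 1 + + sizes cs                       ≡⟨ sym (size-root (node cs)) ⟩
  + size (node cs)                       ∎
  where
  open ≡-Reasoning
  cancel : ∀ t m → t + m - t + + 1 ≡ + 1 + m
  cancel = solve-∀

lemma5 : (T : Tree) (u : Node T) (t : ℤ) →
    b̅ (assignClassic (subtreeAt u) t) - a (assignClassic (subtreeAt u) t) + + 1
      ≡ + descendantsCount u
lemma5 T u t = span-size (subtreeAt u) t
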